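{- Let $A$ be a finite alphabet with $|A|\ge 2$, let $L\subseteq A^*$ and $m\geq 0$. Then: 1. $L^-(m)=\overline{L}^+(m)$, where $\overline{L}=A^*\setminus L$. 2. $L^+(0)=\langle L\rangle_\sqsubseteq$ and $L^-(0)=\langle \overline{L}\rangle_\sqsubseteq$. 3. $L^+(m+1)\cup L^-(m+1)\subseteq L^+(m)\cap L^-(m)$. 4. $v\notin L^+(m)\cup L^-(m)$ for every $v\in A^*$ and every $m>|v|$. 5. $\bigcap_{m\geq 0}L^+(m)=\bigcap_{m\geq 0}L^-(m)=\emptyset$. 6. If $L^+(m)\neq\emptyset$ then $L^+(m+1)\subsetneq L^+(m)$, and if $L^-(m)\neq\emptyset$ then $L^-(m+1)\subsetneq L^-(m)$. 7. $L^+(m)=\langle L^+(m)\rangle_\sqsubseteq$ and $L^-(m)=\langle L^-(m)\rangle_\sqsubseteq$.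
   Context: Subword relation: $w\sqsubseteq v$ iff there are $n\geq 0$, $a_1,\dots,a_n\in A$, $v_0,\dots,v_n\in A^*$ with $w=a_1\cdots a_n$ and $v=v_0a_1v_1\cdots a_nv_n$. For $L\subseteq A^*$, $\langle L\rangle_\sqsubseteq=\{v: \exists w\in L,\ w\sqsubseteq v\}$. For $m\geq 0$ and $w,v\in A^*$, write $w\to^m_L v$ iff there exist $w_0,\dots,w_m\in A^*$ with $w=w_0\sqsubseteq w_1\sqsubseteq\cdots\sqsubseteq w_m\sqsubseteq v$ and ($w_i\in L\iff w_{i+1}\notin L$) for $0\leq i\leq m-1$. Define $L^+(m)=\{v\in A^*:\exists w\in L,\ w\to^m_L v\}$ and $L^-(m)=\{v\in A^*:\exists w\notin L,\ w\to^m_L v\}$. -}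

module Defs where

open import Data.Nat using (ℕ; zero; suc)
open import Data.Bool using (Bool; true; false; not)
open import Data.List using (List)
open import Data.Product using (Σ; _×_; ∃)
open import Relation.Binary.PropositionalEquality using (_≡_)
import Data.List.Relation.Binary.Sublist.Propositional as SL

-- A language over alphabet A is a subset of A*, given by its
-- characteristic function (classically every subset is one).
Lang : Set → Set
Lang A = List A → Bool

_⊑_ : {A : Set} → List A → List A → Set
_⊑_ {A} w v = SL._⊆_ {A = A} w v

compl : {A : Set} → Lang A → Lang A
compl L w = not (L w)

UpClosure : {A : Set} → (List A → Set) → List A → Set
UpClosure P v = ∃ λ w → P w × (w ⊑ v)

-- w →^m_L v : there are w = w₀ ⊑ w₁ ⊑ ⋯ ⊑ w_m ⊑ v with
-- (w_i ∈ L ⇔ w_{i+1} ∉ L), i.e. L w_{i+1} = not (L w_i).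
data Chain {A : Set} (L : Lang A) : ℕ → List A → List A → Set where
  done : ∀ {w v} → w ⊑ v → Chain L zero w v
  step : ∀ {m w w′ v} → w ⊑ w′ → L w′ ≡ not (L w) →
         Chain L m w′ v → Chain L (suc m) w v

Lplus : {A : Set} → Lang A → ℕ → List A → Set
Lplus L m v = ∃ λ w → (L w ≡ true) × Chain L m w v

Lminus : {A : Set} → Lang A → ℕ → List A → Set
Lminus L m v = ∃ λ w → (L w ≡ false) × Chain L m w v

{-# OPTIONS --safe #-}
-- Every alternating step w ⊑ w′ with L w′ ≡ not (L w) strictly lengthens the word,
-- so an m-chain below v forces m ≤ |v|; this gives items 4 and 5. Items 1, 2, 3 and 7
-- are manipulations of chains. For item 6, the penultimate word of an (m+1)-chain below
-- v is a shorter word reached by an m-chain; as reachability is decidable over a finite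
-- alphabet, descending along such words from any v in L^±(m) ends at a word outside
-- L^±(m+1).
module Submission where

open import Defs
open import Data.Nat using (ℕ; suc; _+_; _≤_; _<_)
open import Data.Nat.Properties using (≤-trans; <-≤-trans; ≤∧≢⇒<; +-monoʳ-<; m≤m+n; <⇒≱; n<1+n)
open import Data.Nat.Induction using (<-wellFounded)
open import Data.Fin using (Fin)
open import Data.Fin.Properties using () renaming (_≟_ to _≟ᶠ_)
open import Data.Bool using (Bool; true; not)
open import Data.Bool.Properties using (not-injective; not-involutive; not-¬) renaming (_≟_ to _≟ᵇ_)
open import Data.List using (List; []; _∷_; length)
open import Data.List.Relation.Binary.Sublist.Heterogeneous using ([]; _∷_; _∷ʳ_)
open import Data.List.Relation.Binary.Sublist.Heterogeneous.Properties
  using (length-mono-≤; toPointwise)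
open import Data.List.Relation.Binary.Sublist.Propositional using (⊆-refl; ⊆-trans)
open import Data.List.Relation.Binary.Pointwise using (Pointwise-≡⇒≡)
import Data.List.Relation.Binary.Sublist.DecPropositional as DecSublist
open import Data.Product using (_×_; ∃; _,_)
open import Data.Sum using (_⊎_; inj₁; inj₂; [_,_])
open import Function using (_∘_)
open import Function.Bundles using (_⇔_; mk⇔)
open import Function.Construct.Composition using (_⇔-∘_)
open import Induction.WellFounded using (Acc; acc)
open import Relation.Nullary using (¬_; Dec; yes; no)
open import Relation.Nullary.Decidable using (map′; _×-dec_; _⊎-dec_)
open import Relation.Binary.Definitions using (DecidableEquality)
open import Relation.Binary.PropositionalEquality using (_≡_; _≢_; refl; sym; trans; cong)

private
  variable
    A : Set
    L : Lang A
    b : Bool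
    m : ℕ
    u v w w′ : List A

Reach : Lang A → Bool → ℕ → List A → Set
Reach L b m v = ∃ λ w → L w ≡ b × Chain L m w v

⊑∧≢⇒length< : w ⊑ w′ → w ≢ w′ → length w < length w′
⊑∧≢⇒length< w⊑w′ w≢w′ =
  ≤∧≢⇒< (length-mono-≤ w⊑w′) λ |w|≡|w′| →
    w≢w′ (Pointwise-≡⇒≡ (toPointwise |w|≡|w′| w⊑w′))

alternation⇒length< : w ⊑ w′ → L w′ ≡ not (L w) → length w < length w′
alternation⇒length< {L = L} w⊑w′ alt =
  ⊑∧≢⇒length< w⊑w′ λ w≡w′ → not-¬ (cong L (sym w≡w′)) alt

Chain⇒⊑ : Chain L m w v → w ⊑ v
Chain⇒⊑ (done w⊑v)      = w⊑v
Chain⇒⊑ (step w⊑w′ _ c) = ⊆-trans w⊑w′ (Chain⇒⊑ c)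

Chain⇒length : Chain L m w v → m + length w ≤ length v
Chain⇒length (done w⊑v) = length-mono-≤ w⊑v
Chain⇒length {m = suc m} (step w⊑w′ alt c) =
  ≤-trans (+-monoʳ-< m (alternation⇒length< w⊑w′ alt)) (Chain⇒length c)

Chain-monoʳ : Chain L m w u → u ⊑ v → Chain L m w v
Chain-monoʳ (done w⊑u)        u⊑v = done (⊆-trans w⊑u u⊑v)
Chain-monoʳ (step w⊑w′ alt c) u⊑v = step w⊑w′ alt (Chain-monoʳ c u⊑v)

Chain-init : Chain L (suc m) w v → Chain L m w v
Chain-init (step w⊑w′ _ (done w′⊑v))       = done (⊆-trans w⊑w′ w′⊑v)
Chain-init (step w⊑w′ alt c@(step _ _ _)) = step w⊑w′ alt (Chain-init c)

Chain-init-shorter : Chain L (suc m) w v → ∃ λ u → length u < length v × Chain L m w u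
Chain-init-shorter (step {w = w} w⊑w′ alt (done w′⊑v)) =
  w , <-≤-trans (alternation⇒length< w⊑w′ alt) (length-mono-≤ w′⊑v) , done ⊆-refl
Chain-init-shorter (step w⊑w′ alt c@(step _ _ _)) =
  let u , |u|<|v| , c′ = Chain-init-shorter c in u , |u|<|v| , step w⊑w′ alt c′

Chain-compl : Chain L m w v → Chain (compl L) m w v
Chain-compl (done w⊑v)        = done w⊑v
Chain-compl (step w⊑w′ alt c) = step w⊑w′ (cong not alt) (Chain-compl c)

Chain-compl⁻ : Chain (compl L) m w v → Chain L m w v
Chain-compl⁻ (done w⊑v)        = done w⊑v
Chain-compl⁻ (step w⊑w′ alt c) = step w⊑w′ (not-injective alt) (Chain-compl⁻ c)

Reach-compl : Reach L (not b) m v ⇔ Reach (compl L) b m v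
Reach-compl {L = L} {b = b} = mk⇔
  (λ (w , Lw , c) → w , trans (cong not Lw) (not-involutive b) , Chain-compl c)
  (λ (w , Lw , c) → w , trans (sym (not-involutive (L w))) (cong not Lw) , Chain-compl⁻ c)

Reach-zero : Reach L b 0 v ⇔ UpClosure (λ w → L w ≡ b) v
Reach-zero = mk⇔
  (λ { (w , Lw , done w⊑v) → w , Lw , w⊑v })
  (λ (w , Lw , w⊑v) → w , Lw , done w⊑v)

Reach-upward-closed : Reach L b m v ⇔ UpClosure (Reach L b m) v
Reach-upward-closed = mk⇔
  (λ r → _ , r , ⊆-refl)
  (λ (u , (w , Lw , c) , u⊑v) → w , Lw , Chain-monoʳ c u⊑v)

Reach-suc⇒Reach : Reach L b (suc m) v → Reach L b m v
Reach-suc⇒Reach (w , Lw , c) = w , Lw , Chain-init c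

Reach-suc⇒Reach-not : Reach L b (suc m) v → Reach L (not b) m v
Reach-suc⇒Reach-not (w , refl , step _ alt c) = _ , alt , c

Reach-suc⇒Reach-shorter : Reach L b (suc m) v → ∃ λ u → length u < length v × Reach L b m u
Reach-suc⇒Reach-shorter (w , Lw , c) =
  let u , |u|<|v| , c′ = Chain-init-shorter c in u , |u|<|v| , w , Lw , c′

Reach⇒≤length : Reach L b m v → m ≤ length v
Reach⇒≤length {m = m} (w , _ , c) = ≤-trans (m≤m+n m (length w)) (Chain⇒length c)

length<⇒¬Reach : length v < m → ¬ Reach L b m v
length<⇒¬Reach |v|<m r = <⇒≱ |v|<m (Reach⇒≤length r)

module _ {A : Set} (_≟_ : DecidableEquality A) where
  open DecSublist _≟_ using (_⊆?_)

  ∃⊑? : {P : List A → Set} → (∀ w → Dec (P w)) → ∀ v → Dec (∃ λ w → w ⊑ v × P w)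
  ∃⊑? P? [] = map′ (λ p → [] , [] , p) (λ { (_ , [] , p) → p }) (P? [])
  ∃⊑? P? (x ∷ v) = map′ [ skip , keep ] split (∃⊑? P? v ⊎-dec ∃⊑? (P? ∘ (x ∷_)) v)
    where
    skip : (∃ λ w → w ⊑ v × _) → _
    skip (w , w⊑v , p) = w , x ∷ʳ w⊑v , p
    keep : (∃ λ w → w ⊑ v × _) → _
    keep (w , w⊑v , p) = x ∷ w , refl ∷ w⊑v , p
    split : (∃ λ w → w ⊑ (x ∷ v) × _) → _
    split (w , _ ∷ʳ w⊑v , p)         = inj₁ (w , w⊑v , p)
    split (_ ∷ w , refl ∷ w⊑v , p)  = inj₂ (w , w⊑v , p)

  Chain? : ∀ (L : Lang A) m w v → Dec (Chain L m w v)
  Chain? L 0 w v = map′ done (λ { (done w⊑v) → w⊑v }) (w ⊆? v)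
  Chain? L (suc m) w v = map′
    (λ (_ , _ , w⊑w′ , alt , c) → step w⊑w′ alt c)
    (λ { (step w⊑w′ alt c) → _ , Chain⇒⊑ c , w⊑w′ , alt , c })
    (∃⊑? (λ w′ → w ⊆? w′ ×-dec L w′ ≟ᵇ not (L w) ×-dec Chain? L m w′ v) v)

  Reach? : ∀ (L : Lang A) b m v → Dec (Reach L b m v)
  Reach? L b m v = map′
    (λ (w , _ , Lw , c) → w , Lw , c)
    (λ (w , Lw , c) → w , Chain⇒⊑ c , Lw , c)
    (∃⊑? (λ w → L w ≟ᵇ b ×-dec Chain? L m w v) v)

  Reach-suc-misses : ∀ {L b m} {v : List A} → Reach L b m v →
                     ∃ λ u → Reach L b m u × ¬ Reach L b (suc m) u
  Reach-suc-misses {L} {b} {m} {v} = descend v (<-wellFounded (length v))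
    where
    descend : (v : List A) → Acc _<_ (length v) → Reach L b m v →
              ∃ λ u → Reach L b m u × ¬ Reach L b (suc m) u
    descend v (acc shorter) r with Reach? L b (suc m) v
    ... | no ¬r′ = v , r , ¬r′
    ... | yes r′ =
      let u , |u|<|v| , r″ = Reach-suc⇒Reach-shorter r′ in descend u (shorter |u|<|v|) r″

proposition3p3 : (k : ℕ) → 2 ≤ k → (L : Lang (Fin k)) → (m : ℕ) →
    (∀ v → Lminus L m v ⇔ Lplus (compl L) m v)
  × ((∀ v → Lplus L 0 v ⇔ UpClosure (λ w → L w ≡ true) v)
     × (∀ v → Lminus L 0 v ⇔ UpClosure (λ w → compl L w ≡ true) v))
  × (∀ v → Lplus L (suc m) v ⊎ Lminus L (suc m) v → Lplus L m v × Lminus L m v)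
  × (∀ (v : List (Fin k)) (n : ℕ) → length v < n → ¬ (Lplus L n v ⊎ Lminus L n v))
  × ((∀ v → ¬ (∀ n → Lplus L n v)) × (∀ v → ¬ (∀ n → Lminus L n v)))
  × (((∃ λ v → Lplus L m v) →
        (∀ v → Lplus L (suc m) v → Lplus L m v)
        × (∃ λ v → Lplus L m v × ¬ Lplus L (suc m) v))
     × ((∃ λ v → Lminus L m v) →
        (∀ v → Lminus L (suc m) v → Lminus L m v)
        × (∃ λ v → Lminus L m v × ¬ Lminus L (suc m) v)))
  × ((∀ v → Lplus L m v ⇔ UpClosure (Lplus L m) v)
     × (∀ v → Lminus L m v ⇔ UpClosure (Lminus L m) v))
proposition3p3 k _ L m =
    (λ _ → Reach-compl)
  , ((λ _ → Reach-zero) , (λ _ → Reach-zero ⇔-∘ Reach-compl))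
  , (λ _ → [ (λ r → Reach-suc⇒Reach r , Reach-suc⇒Reach-not r)
           , (λ r → Reach-suc⇒Reach-not r , Reach-suc⇒Reach r) ])
  , (λ _ _ |v|<n → [ length<⇒¬Reach |v|<n , length<⇒¬Reach |v|<n ])
  , (unbounded , unbounded)
  , (strictly-decreasing , strictly-decreasing)
  , ((λ _ → Reach-upward-closed) , (λ _ → Reach-upward-closed))
  where
  unbounded : ∀ {b} v → ¬ (∀ n → Reach L b n v)
  unbounded v all = length<⇒¬Reach (n<1+n (length v)) (all _)

  strictly-decreasing : ∀ {b} → ∃ (Reach L b m) →
    (∀ v → Reach L b (suc m) v → Reach L b m v) × ∃ λ v → Reach L b m v × ¬ Reach L b (suc m) v
  strictly-decreasing (_ , r) = (λ _ → Reach-suc⇒Reach) , Reach-suc-misses _≟ᶠ_ r
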